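{- Let $\pi\preceq\pi'$ be cut-paths in $\mathcal{G}^{n,m}$ and let $S\subseteq\mathcal{G}^{n-1,m-1}$. Let $G=\mathsf{AG}^{n,m}(S)$ and $G'=\mathsf{SAG}^{n,m}(\pi,\pi',S)$. Then for every $p,q\in\mathcal{G}^{n,m}[\pi..\pi']$ we have $\mathrm{dist}_G(p,q)=\mathrm{dist}_{G'}(p,q)$.
   Context: Integer intervals $[a..b]$. Grid $\mathcal{G}^{n,m}=[0..n]\times[0..m]$. For $S\subseteq\mathcal{G}^{n-1,m-1}$, $\mathsf{AG}^{n,m}(S)$ is the undirected weighted graph on $\mathcal{G}^{n,m}$ with weight-$1$ edges $(x,y)$--$(x+1,y)$ and $(x,y)$--$(x,y+1)$ (whenever both endpoints lie in the grid) and weight-$0$ edges $(x,y)$--$(x+1,y+1)$ for $(x,y)\in S$; $\mathrm{dist}$ denotes shortest-path distance. $(x,y)\prec(x',y')$ iff $x<x'$ and $y<y'$; $p\preceq q$ iff $p=q$ or $p\prec q$. An antichain is a set (or sequence) no two elements of which are comparable under $\prec$. Diagonals: $\mathcal{D}^{n,m}_d=\{(x,y)\in\mathcal{G}^{n,m}: x-y=d-m\}$ for $d\in[0..n+m]$. A cut-path is an antichain $\pi=(\pi_d)_{d=0}^{n+m}$ with $\pi_d\in\mathcal{D}^{n,m}_d$. For cut-paths, $\pi\preceq\pi'$ iff $\pi_d\preceq\pi'_d$ for all $d$. The grid slice is $\mathcal{G}^{n,m}[\pi..\pi']=\{(x,y)\in\mathcal{G}^{n,m}:\pi_{x-y+m}\preceq(x,y)\preceq\pi'_{x-y+m}\}$,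 and the slice alignment graph $\mathsf{SAG}^{n,m}(\pi,\pi',S)$ is the subgraph of $\mathsf{AG}^{n,m}(S)$ induced by $\mathcal{G}^{n,m}[\pi..\pi']$. -}

module Defs where

open import Data.Nat using (ℕ; zero; suc; _+_; _∸_; _≤_; _<_)
open import Data.Product using (_×_; _,_; Σ)
open import Data.Sum using (_⊎_)
open import Relation.Nullary using (¬_)
open import Relation.Binary.PropositionalEquality using (_≡_)

Point : Set
Point = ℕ × ℕ

InGrid : ℕ → ℕ → Point → Set
InGrid n m (x , y) = x ≤ n × y ≤ m

_≺_ : Point → Point → Set
(x , y) ≺ (x' , y') = x < x' × y < y'

_⪯_ : Point → Point → Set
p ⪯ q = p ≡ q ⊎ p ≺ q

-- Diagonal D^{n,m}_d = { (x,y) ∈ G^{n,m} : x - y = d - m }  (written x + m = d + y over ℕ)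
OnDiag : ℕ → ℕ → ℕ → Point → Set
OnDiag n m d (x , y) = InGrid n m (x , y) × x + m ≡ d + y

-- Cut-path: π_d ∈ D_d for d ∈ [0..n+m], and (π_d) an antichain.
-- Represented as a function ℕ → Point; only values at d ≤ n+m matter.
record CutPath (n m : ℕ) : Set where
  field
    pt        : ℕ → Point
    onDiag    : ∀ d → d ≤ n + m → OnDiag n m d (pt d)
    antichain : ∀ d d' → d ≤ n + m → d' ≤ n + m → ¬ (pt d ≺ pt d')
open CutPath public

_⪯ᶜ_ : ∀ {n m} → CutPath n m → CutPath n m → Set
_⪯ᶜ_ {n} {m} π π' = ∀ d → d ≤ n + m → pt π d ⪯ pt π' d

InSlice : ∀ {n m} → CutPath n m → CutPath n m → Point → Set
InSlice {n} {m} π π' (x , y) =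
  InGrid n m (x , y) ×
  (pt π (x + m ∸ y) ⪯ (x , y) × (x , y) ⪯ pt π' (x + m ∸ y))

record Graph : Set₁ where
  field
    Vtx : Point → Set
    Edg : Point → Point → ℕ → Set
open Graph public

data Step (n m : ℕ) (S : Point → Set) : Point → Point → ℕ → Set where
  horiz : ∀ {x y} → InGrid n m (x , y) → InGrid n m (suc x , y) →
          Step n m S (x , y) (suc x , y) 1
  vert  : ∀ {x y} → InGrid n m (x , y) → InGrid n m (x , suc y) →
          Step n m S (x , y) (x , suc y) 1
  diag  : ∀ {x y} → S (x , y) → InGrid n m (x , y) → InGrid n m (suc x , suc y) →
          Step n m S (x , y) (suc x , suc y) 0

AG : ℕ → ℕ → (Point → Set) → Graph
Vtx (AG n m S) = InGrid n m
Edg (AG n m S) p q w = Step n m S p q w ⊎ Step n m S q p w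

Induced : Graph → (Point → Set) → Graph
Vtx (Induced G U) p = Vtx G p × U p
Edg (Induced G U) p q w = Edg G p q w × (U p × U q)

SAG : (n m : ℕ) → CutPath n m → CutPath n m → (Point → Set) → Graph
SAG n m π π' S = Induced (AG n m S) (InSlice π π')

data Walk (G : Graph) : Point → Point → ℕ → Set where
  [] : ∀ {p} → Vtx G p → Walk G p p 0
  _∷_ : ∀ {p r q w₁ w₂} → Edg G p r w₁ → Walk G r q w₂ → Walk G p q (w₁ + w₂)

IsDist : Graph → Point → Point → ℕ → Set
IsDist G p q d = Walk G p q d × (∀ w → Walk G p q w → d ≤ w)

-- Clamping every grid point along its diagonal into the segment between π and π'
-- is a retraction of AG onto the slice.  Consecutive points of a cut-path differ by
-- a unit step, so the retraction sends each unit edge to a unit edge of the slice,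
-- and it sends a weight-0 diagonal edge either to itself or to a single point.
-- Hence every walk projects to a slice walk of the same weight with the same
-- endpoints when these lie in the slice, and the two distances agree.
module Submission where

open import Defs
open import Data.Nat using (ℕ; suc; _+_; _∸_; _≤_; _<_; _⊔_; _⊓_; _<?_; _≤?_)
open import Data.Nat.Properties
open import Data.Product using (_×_; _,_; proj₁; proj₂)
open import Data.Sum using (_⊎_; inj₁; inj₂; swap)
open import Relation.Nullary using (¬_; yes; no)
open import Relation.Binary.PropositionalEquality
open import Function.Bundles using (_⇔_; mk⇔)

infix 4 _≤₁_

_≤₁_ : ℕ → ℕ → Set
a ≤₁ b = b ≡ a ⊎ b ≡ suc a

≤₁⇒≤×≤suc : ∀ {a b} → a ≤₁ b → a ≤ b × b ≤ suc a
≤₁⇒≤×≤suc (inj₁ refl) = ≤-refl , n≤1+n _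
≤₁⇒≤×≤suc (inj₂ refl) = n≤1+n _ , ≤-refl

≤×≤suc⇒≤₁ : ∀ {a b} → a ≤ b → b ≤ suc a → a ≤₁ b
≤×≤suc⇒≤₁ a≤b b≤1+a with m≤n⇒m<n∨m≡n a≤b
... | inj₂ a≡b = inj₁ (sym a≡b)
... | inj₁ a<b = inj₂ (≤-antisym b≤1+a a<b)

clamp : ℕ → ℕ → ℕ → ℕ
clamp lo hi x = lo ⊔ (x ⊓ hi)

clamp-lower : ∀ lo hi x → lo ≤ clamp lo hi x
clamp-lower lo _ _ = m≤m⊔n lo _

clamp-upper : ∀ {lo hi} x → lo ≤ hi → clamp lo hi x ≤ hi
clamp-upper {hi = hi} x lo≤hi = ⊔-lub lo≤hi (m⊓n≤n x hi)

clamp-fixed : ∀ {lo hi x} → lo ≤ x → x ≤ hi → clamp lo hi x ≡ x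
clamp-fixed {lo} lo≤x x≤hi =
  trans (cong (lo ⊔_) (m≤n⇒m⊓n≡m x≤hi)) (m≤n⇒m⊔n≡n lo≤x)

-- The upper bound relies on suc (a ⊔ b) and suc (a ⊓ b) reducing to suc a ⊔ suc b, suc a ⊓ suc b.
clamp-mono-≤₁ : ∀ {lo lo' hi hi' x x'} → lo ≤₁ lo' → hi ≤₁ hi' → x ≤₁ x' →
                clamp lo hi x ≤₁ clamp lo' hi' x'
clamp-mono-≤₁ lo≤₁lo' hi≤₁hi' x≤₁x' =
  ≤×≤suc⇒≤₁ (⊔-mono-≤ (proj₁ l) (⊓-mono-≤ (proj₁ x) (proj₁ h)))
            (⊔-mono-≤ (proj₂ l) (⊓-mono-≤ (proj₂ x) (proj₂ h)))
  where
  l = ≤₁⇒≤×≤suc lo≤₁lo'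
  h = ≤₁⇒≤×≤suc hi≤₁hi'
  x = ≤₁⇒≤×≤suc x≤₁x'

clamp-suc : ∀ lo hi x → clamp lo hi (suc x) ≡ clamp lo hi x ⊎ (lo ≤ x × suc x ≤ hi)
clamp-suc lo hi x with x <? lo | hi ≤? x
... | yes x<lo | _ =
  inj₁ (trans (m≥n⇒m⊔n≡m (≤-trans (m⊓n≤m (suc x) hi) x<lo))
              (sym (m≥n⇒m⊔n≡m (≤-trans (m⊓n≤m x hi) (<⇒≤ x<lo)))))
... | no _ | yes hi≤x = inj₁ (cong (lo ⊔_) (trans (m≥n⇒m⊓n≡n (m≤n⇒m≤1+n hi≤x))
                                                  (sym (m≥n⇒m⊓n≡n hi≤x))))
... | no x≮lo | no hi≰x = inj₂ (≮⇒≥ x≮lo , ≰⇒> hi≰x)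

⪯⇒≤ : ∀ {p q} → p ⪯ q → proj₁ p ≤ proj₁ q × proj₂ p ≤ proj₂ q
⪯⇒≤ (inj₁ refl) = ≤-refl , ≤-refl
⪯⇒≤ (inj₂ (x<x' , y<y')) = <⇒≤ x<x' , <⇒≤ y<y'

⪯-inGrid : ∀ {n m p q} → p ⪯ q → InGrid n m q → InGrid n m p
⪯-inGrid p⪯q (x'≤n , y'≤m) =
  ≤-trans (proj₁ (⪯⇒≤ p⪯q)) x'≤n , ≤-trans (proj₂ (⪯⇒≤ p⪯q)) y'≤m

consecutive-diagonals : ∀ {m E a b a' b'} → a + m ≡ E + b → a' + m ≡ suc E + b' →
                        ¬ ((a , b) ≺ (a' , b')) → ¬ ((a' , b') ≺ (a , b)) → a ≤₁ a'
consecutive-diagonals {m} {E} {a} {b} {a'} {b'} onE onE' a⊀a' a'⊀a =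
  ≤×≤suc⇒≤₁ (≮⇒≥ (λ a'<a → a'⊀a (a'<a , b'<b a'<a)))
            (≮⇒≥ (λ 1+a<a' → a⊀a' (<-trans (n<1+n a) 1+a<a' , b<b' 1+a<a')))
  where
  open ≤-Reasoning
  b'<b : a' < a → b' < b
  b'<b a'<a = +-cancelˡ-< E b' b (begin-strict
    E + b'     <⟨ n<1+n _ ⟩
    suc E + b' ≡⟨ onE' ⟨
    a' + m     <⟨ +-monoˡ-< m a'<a ⟩
    a + m      ≡⟨ onE ⟩
    E + b      ∎)
  b<b' : suc a < a' → b < b'
  b<b' 1+a<a' = +-cancelˡ-< (suc E) b b' (begin-strict
    suc E + b  ≡⟨ cong suc onE ⟨
    suc a + m  <⟨ +-monoˡ-< m 1+a<a' ⟩
    a' + m     ≡⟨ onE' ⟩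
    suc E + b' ∎)

cutPath-step : ∀ {n m E} (σ : CutPath n m) → suc E ≤ n + m →
               proj₁ (pt σ E) ≤₁ proj₁ (pt σ (suc E))
cutPath-step {E = E} σ le =
  consecutive-diagonals (proj₂ (onDiag σ E le')) (proj₂ (onDiag σ (suc E) le))
                        (antichain σ E (suc E) le' le) (antichain σ (suc E) E le le')
  where le' = <⇒≤ le

module Diagonals (m : ℕ) where

  diagonal : Point → ℕ
  diagonal (x , y) = x + m ∸ y

  onDiagonal : ℕ → ℕ → Point
  onDiagonal E X = X , X + m ∸ E

  diagonal-onDiagonal : ∀ {E X} → E ≤ X + m → diagonal (onDiagonal E X) ≡ E
  diagonal-onDiagonal = m∸[m∸n]≡n

  onDiagonal-diagonal : ∀ {x y} → y ≤ x + m → onDiagonal (diagonal (x , y)) x ≡ (x , y)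
  onDiagonal-diagonal {x} y≤x+m = cong (x ,_) (m∸[m∸n]≡n y≤x+m)

  onDiag⇒onDiagonal : ∀ {E a b} → a + m ≡ E + b → (a , b) ≡ onDiagonal E a
  onDiag⇒onDiagonal {E} {a} {b} onE =
    cong (a ,_) (sym (trans (cong (_∸ E) onE) (m+n∸m≡n E b)))

  onDiag⇒≤ : ∀ {E a b} → a + m ≡ E + b → E ≤ a + m
  onDiag⇒≤ {E} {b = b} onE = ≤-trans (m≤m+n E b) (≤-reflexive (sym onE))

  onDiagonal-mono : ∀ {E X X'} → E ≤ X + m → X ≤ X' → onDiagonal E X ⪯ onDiagonal E X'
  onDiagonal-mono E≤X+m X≤X' with m≤n⇒m<n∨m≡n X≤X'
  ... | inj₂ refl = inj₁ refl
  ... | inj₁ X<X' = inj₂ (X<X' , ∸-monoˡ-< (+-monoˡ-< m X<X') E≤X+m)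
EdgeOrStay : Graph → Point → Point → ℕ → Set
EdgeOrStay G p q w = Edg G p q w ⊎ (p ≡ q × w ≡ 0)

walk-prepend : ∀ {G p r q w w'} → EdgeOrStay G p r w → Walk G r q w' → Walk G p q (w + w')
walk-prepend (inj₁ e) W = e ∷ W
walk-prepend (inj₂ (refl , refl)) W = W

induced⇒walk : ∀ {G U p q w} → Walk (Induced G U) p q w → Walk G p q w
induced⇒walk ([] (v , _)) = [] v
induced⇒walk ((e , _) ∷ W) = e ∷ induced⇒walk W

IsDist-⇔ : ∀ {G G' p q} → (∀ {w} → Walk G p q w → Walk G' p q w) →
           (∀ {w} → Walk G' p q w → Walk G p q w) →
           ∀ d → IsDist G p q d ⇔ IsDist G' p q d
IsDist-⇔ G⇒G' G'⇒G d = mk⇔ (λ (W , min) → G⇒G' W , λ w W' → min w (G'⇒G W'))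
                           (λ (W , min) → G'⇒G W , λ w W' → min w (G⇒G' W'))

module Retraction {n m : ℕ} (π π' : CutPath n m) (π⪯π' : π ⪯ᶜ π') (S : Point → Set) where
  open Diagonals m

  Slice : Graph
  Slice = SAG n m π π' S

  lower upper : ℕ → ℕ
  lower E = proj₁ (pt π E)
  upper E = proj₁ (pt π' E)

  Band : ℕ → ℕ → Set
  Band E X = E ≤ n + m × lower E ≤ X × X ≤ upper E

  cutPath-onDiagonal : ∀ {E} (σ : CutPath n m) → E ≤ n + m →
                       pt σ E ≡ onDiagonal E (proj₁ (pt σ E))
  cutPath-onDiagonal {E} σ le = onDiag⇒onDiagonal (proj₂ (onDiag σ E le))

  cutPath-reach : ∀ {E} (σ : CutPath n m) → E ≤ n + m → E ≤ proj₁ (pt σ E) + m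
  cutPath-reach {E} σ le = onDiag⇒≤ (proj₂ (onDiag σ E le))

  band-reach : ∀ {E X} → Band E X → E ≤ X + m
  band-reach (le , lo , _) = ≤-trans (cutPath-reach π le) (+-monoˡ-≤ m lo)

  band-inSlice : ∀ {E X} → Band E X → InSlice π π' (onDiagonal E X)
  band-inSlice {E} {X} b@(le , lo , hi) =
    ⪯-inGrid below (proj₁ (onDiag π' E le)) ,
    subst Between (sym (diagonal-onDiagonal (band-reach b))) (above , below)
    where
    Between : ℕ → Set
    Between E' = pt π E' ⪯ onDiagonal E X × onDiagonal E X ⪯ pt π' E'
    above : pt π E ⪯ onDiagonal E X
    above = subst (_⪯ onDiagonal E X) (sym (cutPath-onDiagonal π le))
                  (onDiagonal-mono {E} (cutPath-reach π le) lo)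
    below : onDiagonal E X ⪯ pt π' E
    below = subst (onDiagonal E X ⪯_) (sym (cutPath-onDiagonal π' le))
                  (onDiagonal-mono {E} (band-reach b) hi)

  inGrid⇒y≤x+m : ∀ {x y} → InGrid n m (x , y) → y ≤ x + m
  inGrid⇒y≤x+m {x} (_ , y≤m) = ≤-trans y≤m (m≤n+m m x)

  inGrid⇒diagonal≤ : ∀ {x y} → InGrid n m (x , y) → diagonal (x , y) ≤ n + m
  inGrid⇒diagonal≤ {x} {y} (x≤n , _) = ≤-trans (m∸n≤m (x + m) y) (+-monoˡ-≤ m x≤n)

  inSlice⇒band : ∀ {x y} → InSlice π π' (x , y) → Band (diagonal (x , y)) x
  inSlice⇒band (g , above , below) =
    inGrid⇒diagonal≤ g , proj₁ (⪯⇒≤ above) , proj₁ (⪯⇒≤ below)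

  band⇒inSlice : ∀ {x y} → InGrid n m (x , y) → Band (diagonal (x , y)) x →
                 InSlice π π' (x , y)
  band⇒inSlice g b =
    subst (InSlice π π') (onDiagonal-diagonal (inGrid⇒y≤x+m g)) (band-inSlice b)

  clampTo : ℕ → ℕ → ℕ
  clampTo E = clamp (lower E) (upper E)

  clampTo-band : ∀ {E} x → E ≤ n + m → Band E (clampTo E x)
  clampTo-band {E} x le =
    le , clamp-lower (lower E) (upper E) x , clamp-upper x (proj₁ (⪯⇒≤ (π⪯π' E le)))

  retractOn : ℕ → ℕ → Point
  retractOn E x = onDiagonal E (clampTo E x)

  retract : Point → Point
  retract (x , y) = retractOn (diagonal (x , y)) x

  retract-inSlice : ∀ {p} → InGrid n m p → InSlice π π' (retract p)
  retract-inSlice {x , _} g = band-inSlice (clampTo-band x (inGrid⇒diagonal≤ g))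

  retract-fixes : ∀ {p} → InSlice π π' p → retract p ≡ p
  retract-fixes {x , y} s@(g , _) = begin
    onDiagonal D (clampTo D x) ≡⟨ cong (onDiagonal D) (clamp-fixed lo hi) ⟩
    onDiagonal D x             ≡⟨ onDiagonal-diagonal (inGrid⇒y≤x+m g) ⟩
    (x , y)                    ∎
    where
    open ≡-Reasoning
    D = diagonal (x , y)
    lo = proj₁ (proj₂ (inSlice⇒band s))
    hi = proj₂ (proj₂ (inSlice⇒band s))

  SliceEdge : Point → Point → ℕ → Set
  SliceEdge = Edg Slice

  SliceEdge-sym : ∀ {p q w} → SliceEdge p q w → SliceEdge q p w
  SliceEdge-sym (e , s , s') = swap e , s' , s

  band-edge : ∀ {E X X'} → Band E X → Band (suc E) X' → X ≤₁ X' →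
              SliceEdge (onDiagonal E X) (onDiagonal (suc E) X') 1
  band-edge b b' (inj₂ refl) = inj₁ (horiz (proj₁ s) (proj₁ s')) , s , s'
    where
    s = band-inSlice b
    s' = band-inSlice b'
  band-edge {E} {X} b b' (inj₁ refl) =
    subst (λ p → SliceEdge p (onDiagonal (suc E) X) 1) (sym above≡)
          (inj₂ (vert (proj₁ s') (proj₁ s)) , s , s')
    where
    above≡ : onDiagonal E X ≡ (X , suc (X + m ∸ suc E))
    above≡ = cong (X ,_) (+-∸-assoc 1 (band-reach b'))
    s = subst (InSlice π π') above≡ (band-inSlice b)
    s' = band-inSlice b'

  retractOn-edge : ∀ {E x x'} → suc E ≤ n + m → x ≤₁ x' →
                   SliceEdge (retractOn E x) (retractOn (suc E) x') 1
  retractOn-edge {x = x} {x'} le x≤₁x' =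
    band-edge (clampTo-band x (<⇒≤ le)) (clampTo-band x' le)
              (clamp-mono-≤₁ (cutPath-step π le) (cutPath-step π' le) x≤₁x')

  retract-step : ∀ {p q w} → Step n m S p q w →
                 EdgeOrStay Slice (retract p) (retract q) w
  retract-step (horiz {x} {y} g g') =
    inj₁ (subst (λ E → SliceEdge (retract (x , y)) (retractOn E (suc x)) 1) (sym D≡)
                (retractOn-edge le (inj₂ refl)))
    where
    D≡ : diagonal (suc x , y) ≡ suc (diagonal (x , y))
    D≡ = +-∸-assoc 1 (inGrid⇒y≤x+m g)
    le = subst (_≤ n + m) D≡ (inGrid⇒diagonal≤ g')
  retract-step (vert {x} {y} g g') =
    inj₁ (subst (λ E → SliceEdge (retractOn E x) (retract (x , suc y)) 1) (sym D≡)
                (SliceEdge-sym (retractOn-edge le (inj₁ refl))))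
    where
    D≡ : diagonal (x , y) ≡ suc (diagonal (x , suc y))
    D≡ = +-∸-assoc 1 (inGrid⇒y≤x+m g')
    le = subst (_≤ n + m) D≡ (inGrid⇒diagonal≤ g)
  retract-step (diag {x} {y} s g g')
    with clamp-suc (lower (diagonal (x , y))) (upper (diagonal (x , y))) x
  ... | inj₁ same = inj₂ (cong (onDiagonal (diagonal (x , y))) (sym same) , refl)
  ... | inj₂ (lo , x<hi) =
    inj₁ (subst₂ (λ p q → SliceEdge p q 0) (sym (retract-fixes sp)) (sym (retract-fixes sq))
                 (inj₁ (diag s g g') , sp , sq))
    where
    le = inGrid⇒diagonal≤ g
    sp = band⇒inSlice g (le , lo , <⇒≤ x<hi)
    sq = band⇒inSlice g' (le , m≤n⇒m≤1+n lo , x<hi)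

  EdgeOrStay-sym : ∀ {p q w} → EdgeOrStay Slice p q w → EdgeOrStay Slice q p w
  EdgeOrStay-sym (inj₁ e) = inj₁ (SliceEdge-sym e)
  EdgeOrStay-sym (inj₂ (p≡q , w≡0)) = inj₂ (sym p≡q , w≡0)

  retract-walk : ∀ {p q w} → Walk (AG n m S) p q w → Walk Slice (retract p) (retract q) w
  retract-walk ([] g) = [] (proj₁ (retract-inSlice g) , retract-inSlice g)
  retract-walk (inj₁ st ∷ W) = walk-prepend (retract-step st) (retract-walk W)
  retract-walk (inj₂ st ∷ W) = walk-prepend (EdgeOrStay-sym (retract-step st)) (retract-walk W)

  slice-walk : ∀ {p q w} → InSlice π π' p → InSlice π π' q →
               Walk (AG n m S) p q w → Walk Slice p q w
  slice-walk sp sq W =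
    subst₂ (λ p q → Walk Slice p q _) (retract-fixes sp) (retract-fixes sq) (retract-walk W)

lemma3p16 : (n m : ℕ) (π π' : CutPath n m) → π ⪯ᶜ π' →
    (S : Point → Set) → (∀ x y → S (x , y) → x < n × y < m) →
    ∀ p q → InSlice π π' p → InSlice π π' q →
    ∀ d → IsDist (AG n m S) p q d ⇔ IsDist (SAG n m π π' S) p q d
lemma3p16 n m π π' π⪯π' S _ p q sp sq = IsDist-⇔ (slice-walk sp sq) induced⇒walk
  where open Retraction π π' π⪯π' S
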